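{- Let $\sigma\in S_k$ and $1\le l<k$ with $\sigma(l)\ne l+1$. In the digraph of $\sigma$ let $a$ be the edge ending at $l+1$ (starting at $\sigma^{ -1}(l+1)$), and $c$ the edge starting at $l$ (ending at $\sigma(l)$). Let $\tilde\sigma\in S_{k-1}$ be the permutation obtained by merging the vertices $l$ and $l+1$ into one vertex and joining the edges $a$ and $c$ into a single edge $a/c$. Precisely, with $\mu(x)=x$ for $x\le l$, $\mu(l+1)=l$, and $\mu(x)=x-1$ for $x>l+1$, the edges of $\tilde\sigma$ are $\mu(x)\to\mu(\sigma(x))$ for each edge $x\to\sigma(x)$ of $\sigma$ other than $a,c$, together with the edge $a/c:\ \mu(\sigma^{ -1}(l+1))\to\mu(\sigma(l))$. Identify each edge of $\sigma$ other than $a,c$ with its image in $\tilde\sigma$. Then, as $\mathbb{Z}_2$-valued functions of the edge variables (which take values in $\{0,1\}$), \[ f_{\tilde\sigma}=f_\sigma\big|_{\bar i_a=\bar i_c=\bar i_{a/c}}, \] that is, $f_{\tilde\sigma}$ is obtained from $f_\sigma$ by setting $\bar i_a=\bar i_c$ (both equal to the variable of the merged edge).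
   Context: For a permutation $\pi\in S_k$, its digraph has vertices $1,\dots,k$ placed in increasing order on a horizontal line and edges $x\to\pi(x)$. For the edge $x\to y$ consider the shifted endpoints $x+\tfrac13$ and $y-\tfrac13$. An edge $x\to y$ is distinguished if $x<y$. Two distinct edges form a distinguished pair if their pairs of shifted endpoints alternate on the line, i.e. exactly one shifted endpoint of one edge lies strictly between the two shifted endpoints of the other. Attach to each edge $e$ a variable $\bar i_e\in\{0,1\}=\mathbb{Z}_2$. The sign function is $f_\pi=\sum_{e\text{ distinguished}}\bar i_e+\sum_{\{e,e'\}\text{ distinguished pair}}\bar i_e\bar i_{e'}\in\mathbb{Z}_2$. -}

module Defs where

open import Data.Bool using (Bool; true; false; _∧_; _∨_; _xor_; if_then_else_)
open import Data.Nat using (ℕ; _*_; _+_)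
import Data.Nat as ℕ
open import Data.Fin using (Fin; toℕ; inject₁; suc; pinch; _≟_)
open import Data.Fin.Permutation using (Permutation′; _⟨$⟩ʳ_; _⟨$⟩ˡ_)
open import Data.List using (List; []; _∷_; foldr; filter; allFin; concatMap; map)
import Relation.Binary.PropositionalEquality
import Data.Product
open import Relation.Nullary.Decidable using (⌊_⌋)

-- Vertices 1..k are represented by Fin k (vertex v ↔ toℕ v, i.e. 0-indexed;
-- only the relative order matters). Edges of π are indexed by their source x
-- (edge x → π x).  Edge variables: an assignment Fin k → Bool (Bool = ℤ₂,
-- addition = xor, multiplication = ∧).

_<ᵇ_ : ℕ → ℕ → Bool
m <ᵇ n = ⌊ m ℕ.<? n ⌋

Σ₂ : List Bool → Bool
Σ₂ = foldr _xor_ false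

-- Shifted endpoints, scaled by 3 and translated by +1 (order-preserving):
--   x + 1/3  ↦ 3x + 2 ,   y - 1/3 ↦ 3y .
srcPt : ℕ → ℕ
srcPt x = 3 * x + 2

tgtPt : ℕ → ℕ
tgtPt y = 3 * y

between : ℕ → ℕ → ℕ → Bool
between z p q = ((p <ᵇ z) ∧ (z <ᵇ q)) ∨ ((q <ᵇ z) ∧ (z <ᵇ p))

module _ {k : ℕ} (π : Permutation′ k) where

  distinguished : Fin k → Bool
  distinguished x = toℕ x <ᵇ toℕ (π ⟨$⟩ʳ x)

  -- edges x, y (distinct) form a distinguished pair iff their shifted
  -- endpoints alternate: exactly one shifted endpoint of edge y lies strictly
  -- between the two shifted endpoints of edge x.
  distPair : Fin k → Fin k → Bool
  distPair x y =
    between (srcPt (toℕ y)) p q xor between (tgtPt (toℕ (π ⟨$⟩ʳ y))) p q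
    where
      p = srcPt (toℕ x)
      q = tgtPt (toℕ (π ⟨$⟩ʳ x))

  -- the sign function f_π as a ℤ₂-valued function of the edge variables;
  -- unordered pairs {e,e'} of distinct edges are enumerated as x < y.
  signFun : (Fin k → Bool) → Bool
  signFun i =
    Σ₂ (map (λ x → distinguished x ∧ i x) (allFin k))
    xor
    Σ₂ (concatMap (λ x → map (λ y → (toℕ x <ᵇ toℕ y) ∧ distPair x y ∧ i x ∧ i y)
                             (allFin k))
                  (allFin k))

-- Merging vertices l and l+1 of a permutation of Fin (suc m), l : Fin m
-- (vertex l is inject₁ l, vertex l+1 is suc l).
-- μ x = x for x ≤ l, μ (l+1) = l, μ x = x - 1 for x > l+1; this is exactly
-- the library function pinch l.
μ : {m : ℕ} → Fin m → Fin (ℕ.suc m) → Fin m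
μ l = pinch l

module _ {m : ℕ} (σ : Permutation′ (ℕ.suc m)) (l : Fin m) where

  aSrc : Fin (ℕ.suc m)
  aSrc = σ ⟨$⟩ˡ suc l

  cSrc : Fin (ℕ.suc m)
  cSrc = inject₁ l

  IsMerge : Permutation′ m → Set
  IsMerge σ̃ =
    ((x : Fin (ℕ.suc m)) → x Relation.Binary.PropositionalEquality.≢ aSrc →
       x Relation.Binary.PropositionalEquality.≢ cSrc →
       σ̃ ⟨$⟩ʳ μ l x Relation.Binary.PropositionalEquality.≡ μ l (σ ⟨$⟩ʳ x))
    Data.Product.×
    (σ̃ ⟨$⟩ʳ μ l aSrc Relation.Binary.PropositionalEquality.≡ μ l (σ ⟨$⟩ʳ cSrc))

  -- Given an assignment j of the edge variables of σ̃, the induced assignment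
  -- of the edge variables of σ: each edge other than a, c gets the variable of
  -- its image; a and c both get the variable of the merged edge a/c
  -- (whose source in σ̃ is μ aSrc).
  liftVars : (Fin m → Bool) → Fin (ℕ.suc m) → Bool
  liftVars j x = if ⌊ x ≟ cSrc ⌋ then j (μ l aSrc) else j (μ l x)

{-# OPTIONS --safe #-}
-- Modulo 2, a point z ∉ {p, q} lies strictly between p and q iff [p < z] + [z < q] = 1.
-- Applied to both shifted endpoints of y → y′, this shows that distinct edges x → x′ and
-- y → y′ form a distinguished pair iff [x < y] + [y < x′] + [x < y′] + [y′ < x′] = 1: the
-- shifts disappear, leaving a sum of comparisons of vertices that is symmetric in the two
-- edges. The merge map μ preserves every comparison except l < l + 1, which in f_σ̃ can
-- only arise between the source l of c and the target l + 1 of a. Hence every term of f_σ̃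
-- not involving a/c is the corresponding term of f_σ, and the crossing form of a/c with
-- another edge is the sum of those of a and c (the comparisons with l and l + 1 cancel).
-- Finally, when σ(l) ≠ l + 1, [a < σ(l)] = [l < σ(l)] + [a < l + 1] + (crossing form of a
-- and c), so with i_a = i_c the linear term of a/c is the sum of the linear terms of a and
-- c and of the pair term of {a, c}.
module Submission where

open import Defs
open import Data.Nat using (ℕ; zero; suc; _<_; _≤_; _≮_; _*_; z<s; s<s; s≤s; s<s⁻¹; s≤s⁻¹)
open import Data.Nat.Properties
  using (_<?_; <-cmp; ≤-trans; ≤-reflexive; <⇒≯; <⇒≱; ≮⇒≥; ≤∧≢⇒<; n<1+n; <-irrefl; <-trans; ≤-<-trans; m<m+n; *-suc; +-comm;
         *-monoʳ-<; *-monoʳ-≤; *-cancelˡ-<; *-cancelˡ-≡; +-monoˡ-<; +-cancelʳ-<; +-cancelʳ-≡)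
open import Data.Bool using (Bool; true; false; not; _xor_; _∧_; _∨_; if_then_else_)
open import Data.Bool.Properties using (xor-∧-commutativeRing; xor-assoc; ∧-idem; ∧-comm; ∧-distribʳ-xor)
open import Data.Bool.Solver using (module xor-∧-Solver)
import Data.Fin as F
open F using (Fin; zero; suc; toℕ; inject₁; pinch; punchIn; _≟_)
open import Data.Fin.Properties using (toℕ-injective; toℕ-inject₁; punchInᵢ≢i; punchIn-injective)
open import Data.Fin.Permutation using (Permutation′; _⟨$⟩ʳ_; inverseʳ)
open import Data.List using (List; []; _∷_; _++_; map; tabulate; allFin; concatMap)
open import Data.Product using (proj₁; proj₂)
open import Data.Sum using (_⊎_; inj₁; inj₂; [_,_]′)
import Data.Sum as Sum
open import Function using (_∘_; id)
open import Function.Bundles using (Injection)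
open import Function.Properties.Inverse using (↔⇒↣)
open import Relation.Binary using (tri<; tri≈; tri>)
open import Relation.Binary.PropositionalEquality using (_≡_; _≢_; refl; sym; trans; cong; cong₂; module ≡-Reasoning)
open import Relation.Nullary using (yes; no; contradiction)
open import Relation.Nullary.Decidable using (isYes≗does; dec-true; dec-false)
open import Algebra.Bundles using (CommutativeRing)
open import Algebra.Properties.CommutativeMonoid.Sum (CommutativeRing.+-commutativeMonoid xor-∧-commutativeRing)
  using (sum; sum-remove; ∑-distrib-+; sum-cong-≗)

open xor-∧-Solver using (solve; _:=_; _:+_; _:*_; con)
open ≡-Reasoning

<ᵇ-true : ∀ {m n} → m < n → m <ᵇ n ≡ true
<ᵇ-true {m} {n} m<n = trans (isYes≗does (m <? n)) (dec-true (m <? n) m<n)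

<ᵇ-false : ∀ {m n} → m ≮ n → m <ᵇ n ≡ false
<ᵇ-false {m} {n} m≮n = trans (isYes≗does (m <? n)) (dec-false (m <? n) m≮n)

<ᵇ-cong : ∀ {m n p q} → (m < n → p < q) → (p < q → m < n) → m <ᵇ n ≡ p <ᵇ q
<ᵇ-cong {m} {n} to from with m <? n
... | yes m<n = sym (<ᵇ-true (to m<n))
... | no m≮n = sym (<ᵇ-false (m≮n ∘ from))

<ᵇ-irrefl : ∀ n → n <ᵇ n ≡ false
<ᵇ-irrefl n = <ᵇ-false (<-irrefl refl)

<ᵇ-flip : ∀ {m n} → m ≢ n → n <ᵇ m ≡ not (m <ᵇ n)
<ᵇ-flip {m} {n} m≢n with <-cmp m n
... | tri< m<n _ _ = trans (<ᵇ-false (<⇒≯ m<n)) (sym (cong not (<ᵇ-true m<n)))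
... | tri≈ _ m≡n _ = contradiction m≡n m≢n
... | tri> _ _ n<m = trans (<ᵇ-true n<m) (sym (cong not (<ᵇ-false (<⇒≯ n<m))))

<ᵇ-sucʳ : ∀ m n → m <ᵇ suc n ≡ not (n <ᵇ m)
<ᵇ-sucʳ m n with n <? m
... | yes n<m = <ᵇ-false (<⇒≱ n<m ∘ s≤s⁻¹)
... | no n≮m = <ᵇ-true (s≤s (≮⇒≥ n≮m))

<ᵇ-suc-suc : ∀ m n → suc m <ᵇ suc n ≡ m <ᵇ n
<ᵇ-suc-suc m n = <ᵇ-cong s<s⁻¹ s<s

<ᵇ-sucˡ : ∀ {m n} → n ≢ suc m → suc m <ᵇ n ≡ m <ᵇ n
<ᵇ-sucˡ {m} n≢1+m = <ᵇ-cong (<-trans (n<1+n m)) (λ m<n → ≤∧≢⇒< m<n (n≢1+m ∘ sym))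

srcPt-injective : ∀ {a b} → srcPt a ≡ srcPt b → a ≡ b
srcPt-injective {a} {b} eq = *-cancelˡ-≡ a b 3 (+-cancelʳ-≡ 2 (3 * a) (3 * b) eq)

tgtPt-injective : ∀ {a b} → tgtPt a ≡ tgtPt b → a ≡ b
tgtPt-injective {a} {b} = *-cancelˡ-≡ a b 3

srcPt<tgtPt : ∀ {a b} → a < b → srcPt a < tgtPt b
srcPt<tgtPt {a} a<b = ≤-trans (≤-reflexive 1+srcPt≡3*[1+a]) (*-monoʳ-≤ 3 a<b)
  where
  1+srcPt≡3*[1+a] : suc (srcPt a) ≡ 3 * suc a
  1+srcPt≡3*[1+a] = trans (cong suc (+-comm (3 * a) 2)) (sym (*-suc 3 a))

tgtPt<srcPt : ∀ {a b} → b ≤ a → tgtPt b < srcPt a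
tgtPt<srcPt {a} b≤a = ≤-<-trans (*-monoʳ-≤ 3 b≤a) (m<m+n (3 * a) z<s)

srcPt≢tgtPt : ∀ a b → srcPt a ≢ tgtPt b
srcPt≢tgtPt a b eq with a <? b
... | yes a<b = <-irrefl eq (srcPt<tgtPt a<b)
... | no a≮b = <-irrefl (sym eq) (tgtPt<srcPt (≮⇒≥ a≮b))

srcPt-<ᵇ-srcPt : ∀ a b → srcPt a <ᵇ srcPt b ≡ a <ᵇ b
srcPt-<ᵇ-srcPt a b =
  <ᵇ-cong (*-cancelˡ-< 3 a b ∘ +-cancelʳ-< 2 (3 * a) (3 * b)) (+-monoˡ-< 2 ∘ *-monoʳ-< 3)

tgtPt-<ᵇ-tgtPt : ∀ a b → tgtPt a <ᵇ tgtPt b ≡ a <ᵇ b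
tgtPt-<ᵇ-tgtPt a b = <ᵇ-cong (*-cancelˡ-< 3 a b) (*-monoʳ-< 3)

srcPt-<ᵇ-tgtPt : ∀ a b → srcPt a <ᵇ tgtPt b ≡ a <ᵇ b
srcPt-<ᵇ-tgtPt a b with a <? b
... | yes a<b = <ᵇ-true (srcPt<tgtPt a<b)
... | no a≮b = <ᵇ-false (<⇒≯ (tgtPt<srcPt (≮⇒≥ a≮b)))

between-xor : ∀ {z p q} → z ≢ p → z ≢ q → between z p q ≡ not ((p <ᵇ z) xor (z <ᵇ q))
between-xor {z} {p} {q} z≢p z≢q = begin
  (p <ᵇ z ∧ z <ᵇ q) ∨ (q <ᵇ z ∧ z <ᵇ p)
    ≡⟨ cong₂ (λ u v → (p <ᵇ z ∧ z <ᵇ q) ∨ (u ∧ v)) (<ᵇ-flip z≢q) (<ᵇ-flip (z≢p ∘ sym)) ⟩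
  (p <ᵇ z ∧ z <ᵇ q) ∨ (not (z <ᵇ q) ∧ not (p <ᵇ z))
    ≡⟨ both-or-neither (p <ᵇ z) (z <ᵇ q) ⟩
  not ((p <ᵇ z) xor (z <ᵇ q)) ∎
  where
  both-or-neither : ∀ x y → (x ∧ y) ∨ (not y ∧ not x) ≡ not (x xor y)
  both-or-neither false false = refl
  both-or-neither false true = refl
  both-or-neither true false = refl
  both-or-neither true true = refl

crossing : ℕ → ℕ → ℕ → ℕ → Bool
crossing x y x′ y′ = (x <ᵇ y) xor (y <ᵇ x′) xor (x <ᵇ y′) xor (y′ <ᵇ x′)

crossing-cong : ∀ {x y x′ y′ u v u′ v′} → x ≡ u → y ≡ v → x′ ≡ u′ → y′ ≡ v′ →
                crossing x y x′ y′ ≡ crossing u v u′ v′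
crossing-cong refl refl refl refl = refl

crossing-sym : ∀ {x y x′ y′} → x ≢ y → x′ ≢ y′ → crossing y x y′ x′ ≡ crossing x y x′ y′
crossing-sym {x} {y} {x′} {y′} x≢y x′≢y′ = begin
  (y <ᵇ x) xor (x <ᵇ y′) xor (y <ᵇ x′) xor (x′ <ᵇ y′)
    ≡⟨ cong₂ (λ u v → u xor (x <ᵇ y′) xor (y <ᵇ x′) xor v) (<ᵇ-flip x≢y) (<ᵇ-flip (x′≢y′ ∘ sym)) ⟩
  not (x <ᵇ y) xor (x <ᵇ y′) xor (y <ᵇ x′) xor not (y′ <ᵇ x′)
    ≡⟨ solve 4 (λ a b c d → (con true :+ a) :+ (c :+ (b :+ (con true :+ d))) := a :+ (b :+ (c :+ d)))
             refl (x <ᵇ y) (y <ᵇ x′) (x <ᵇ y′) (y′ <ᵇ x′) ⟩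
  crossing x y x′ y′ ∎

crossing-split : ∀ a w s t l → crossing a w s t ≡ crossing a w (suc l) t xor crossing l w s t
crossing-split a w s t l = begin
  crossing a w s t
    ≡⟨ solve 6 (λ A B C D E F → A :+ (B :+ (C :+ D))
                             := (A :+ ((con true :+ E) :+ (C :+ (con true :+ F)))) :+ (E :+ (B :+ (F :+ D))))
             refl (a <ᵇ w) (w <ᵇ s) (a <ᵇ t) (t <ᵇ s) (l <ᵇ w) (l <ᵇ t) ⟩
  ((a <ᵇ w) xor not (l <ᵇ w) xor (a <ᵇ t) xor not (l <ᵇ t)) xor crossing l w s t
    ≡⟨ sym (cong₂ (λ u v → ((a <ᵇ w) xor u xor (a <ᵇ t) xor v) xor crossing l w s t)
                  (<ᵇ-sucʳ w l) (<ᵇ-sucʳ t l)) ⟩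
  crossing a w (suc l) t xor crossing l w s t ∎

<ᵇ-merge : ∀ a s l → s ≢ suc l → a <ᵇ s ≡ (l <ᵇ s) xor (a <ᵇ suc l) xor crossing l a s (suc l)
<ᵇ-merge a s l s≢1+l = begin
  a <ᵇ s
    ≡⟨ solve 3 (λ A P L → A := L :+ ((con true :+ P) :+ (P :+ (A :+ (con true :+ L))))) refl (a <ᵇ s) (l <ᵇ a) (l <ᵇ s) ⟩
  (l <ᵇ s) xor not (l <ᵇ a) xor (l <ᵇ a) xor (a <ᵇ s) xor true xor (l <ᵇ s)
    ≡⟨ sym (cong₂ (λ u v → (l <ᵇ s) xor u xor (l <ᵇ a) xor (a <ᵇ s) xor v)
                  (<ᵇ-sucʳ a l) (cong₂ _xor_ (<ᵇ-true (n<1+n l)) (<ᵇ-sucˡ s≢1+l))) ⟩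
  (l <ᵇ s) xor (a <ᵇ suc l) xor crossing l a s (suc l) ∎

module _ {k : ℕ} (π : Permutation′ k) where

  ⟨$⟩ʳ-injective : ∀ {x y} → π ⟨$⟩ʳ x ≡ π ⟨$⟩ʳ y → x ≡ y
  ⟨$⟩ʳ-injective = Injection.injective (↔⇒↣ π)

  crossingAt : Fin k → Fin k → Bool
  crossingAt x y = crossing (toℕ x) (toℕ y) (toℕ (π ⟨$⟩ʳ x)) (toℕ (π ⟨$⟩ʳ y))

  distPair≡crossingAt : ∀ {x y} → x ≢ y → distPair π x y ≡ crossingAt x y
  distPair≡crossingAt {x} {y} x≢y = begin
    between (srcPt b) (srcPt a) (tgtPt a′) xor between (tgtPt b′) (srcPt a) (tgtPt a′)
      ≡⟨ cong₂ _xor_ (between-xor (a≢b ∘ sym ∘ srcPt-injective) (srcPt≢tgtPt b a′))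
                     (between-xor (srcPt≢tgtPt a b′ ∘ sym) (a′≢b′ ∘ sym ∘ tgtPt-injective)) ⟩
    not (srcPt a <ᵇ srcPt b xor srcPt b <ᵇ tgtPt a′) xor not (srcPt a <ᵇ tgtPt b′ xor tgtPt b′ <ᵇ tgtPt a′)
      ≡⟨ cong₂ (λ u v → not u xor not v)
               (cong₂ _xor_ (srcPt-<ᵇ-srcPt a b) (srcPt-<ᵇ-tgtPt b a′))
               (cong₂ _xor_ (srcPt-<ᵇ-tgtPt a b′) (tgtPt-<ᵇ-tgtPt b′ a′)) ⟩
    not ((a <ᵇ b) xor (b <ᵇ a′)) xor not ((a <ᵇ b′) xor (b′ <ᵇ a′))
      ≡⟨ solve 4 (λ A B C D → (con true :+ (A :+ B)) :+ (con true :+ (C :+ D)) := A :+ (B :+ (C :+ D)))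
               refl (a <ᵇ b) (b <ᵇ a′) (a <ᵇ b′) (b′ <ᵇ a′) ⟩
    crossingAt x y ∎
    where
    a b a′ b′ : ℕ
    a = toℕ x
    b = toℕ y
    a′ = toℕ (π ⟨$⟩ʳ x)
    b′ = toℕ (π ⟨$⟩ʳ y)
    a≢b : a ≢ b
    a≢b = x≢y ∘ toℕ-injective
    a′≢b′ : a′ ≢ b′
    a′≢b′ = x≢y ∘ ⟨$⟩ʳ-injective ∘ toℕ-injective

  crossingAt-sym : ∀ {x y} → x ≢ y → crossingAt y x ≡ crossingAt x y
  crossingAt-sym x≢y = crossing-sym (x≢y ∘ toℕ-injective) (x≢y ∘ ⟨$⟩ʳ-injective ∘ toℕ-injective)

Σ₂-++ : ∀ xs ys → Σ₂ (xs ++ ys) ≡ Σ₂ xs xor Σ₂ ys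
Σ₂-++ [] ys = refl
Σ₂-++ (x ∷ xs) ys = trans (cong (x xor_) (Σ₂-++ xs ys)) (sym (xor-assoc x (Σ₂ xs) (Σ₂ ys)))

Σ₂-concatMap : ∀ {A : Set} (g : A → List Bool) xs → Σ₂ (concatMap g xs) ≡ Σ₂ (map (Σ₂ ∘ g) xs)
Σ₂-concatMap g [] = refl
Σ₂-concatMap g (x ∷ xs) = trans (Σ₂-++ (g x) (concatMap g xs)) (cong (Σ₂ (g x) xor_) (Σ₂-concatMap g xs))

Σ₂-map-tabulate : ∀ {A : Set} {n} (f : A → Bool) (g : Fin n → A) → Σ₂ (map f (tabulate g)) ≡ sum (f ∘ g)
Σ₂-map-tabulate {n = zero} f g = refl
Σ₂-map-tabulate {n = suc n} f g = cong (f (g zero) xor_) (Σ₂-map-tabulate f (g ∘ suc))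

quadForm : ∀ {n} → (Fin n → Bool) → (Fin n → Fin n → Bool) → Bool
quadForm s t = sum s xor sum (λ x → sum (t x))

quadForm-remove : ∀ {n} (v : Fin (suc n)) (s : Fin (suc n) → Bool) (t : Fin (suc n) → Fin (suc n) → Bool) →
  t v v ≡ false →
  quadForm s t ≡ s v xor sum (λ y → t v (punchIn v y) xor t (punchIn v y) v)
                     xor quadForm (s ∘ punchIn v) (λ x y → t (punchIn v x) (punchIn v y))
quadForm-remove v s t tvv≡false = begin
  sum s xor sum (λ x → sum (t x))
    ≡⟨ cong₂ _xor_ (sum-remove s)
                   (trans (sum-remove (λ x → sum (t x)))
                          (cong₂ _xor_ (sum-remove (t v))
                                       (trans (sum-cong-≗ (λ x → sum-remove (t (punchIn v x))))
                                              (∑-distrib-+ col rest)))) ⟩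
  (s v xor sum (s ∘ punchIn v)) xor ((t v v xor sum row) xor (sum col xor sum rest))
    ≡⟨ cong (λ b → (s v xor sum (s ∘ punchIn v)) xor ((b xor sum row) xor (sum col xor sum rest))) tvv≡false ⟩
  (s v xor sum (s ∘ punchIn v)) xor (sum row xor (sum col xor sum rest))
    ≡⟨ solve 5 (λ A B C D E → (A :+ B) :+ (C :+ (D :+ E)) := A :+ ((C :+ D) :+ (B :+ E)))
             refl (s v) (sum (s ∘ punchIn v)) (sum row) (sum col) (sum rest) ⟩
  s v xor (sum row xor sum col) xor (sum (s ∘ punchIn v) xor sum rest)
    ≡⟨ cong (λ u → s v xor u xor (sum (s ∘ punchIn v) xor sum rest)) (sym (∑-distrib-+ row col)) ⟩
  s v xor sum (λ y → row y xor col y) xor quadForm (s ∘ punchIn v) (λ x y → t (punchIn v x) (punchIn v y)) ∎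
  where
  row col : Fin _ → Bool
  row y = t v (punchIn v y)
  col x = t (punchIn v x) v
  rest : Fin _ → Bool
  rest x = sum (λ y → t (punchIn v x) (punchIn v y))

module _ {k : ℕ} (π : Permutation′ k) (i : Fin k → Bool) where

  linearTerm : Fin k → Bool
  linearTerm x = distinguished π x ∧ i x

  pairTerm : Fin k → Fin k → Bool
  pairTerm x y = (toℕ x <ᵇ toℕ y) ∧ crossingAt π x y ∧ i x ∧ i y

  crossTerm : Fin k → Fin k → Bool
  crossTerm x y = crossingAt π x y ∧ i x ∧ i y

  signFunOn : ∀ {r} → (Fin r → Fin k) → Bool
  signFunOn e = quadForm (linearTerm ∘ e) (λ x y → pairTerm (e x) (e y))

  pairTerm-diag : ∀ x → pairTerm x x ≡ false
  pairTerm-diag x = cong (_∧ crossTerm x x) (<ᵇ-irrefl (toℕ x))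

  pairTerm-xor-flip : ∀ {x y} → x ≢ y → pairTerm x y xor pairTerm y x ≡ crossTerm x y
  pairTerm-xor-flip {x} {y} x≢y = begin
    (toℕ x <ᵇ toℕ y) ∧ crossTerm x y xor (toℕ y <ᵇ toℕ x) ∧ crossingAt π y x ∧ i y ∧ i x
      ≡⟨ cong₂ (λ u w → (toℕ x <ᵇ toℕ y) ∧ crossTerm x y xor u ∧ crossingAt π y x ∧ w)
               (<ᵇ-flip (x≢y ∘ toℕ-injective)) (∧-comm (i y) (i x)) ⟩
    (toℕ x <ᵇ toℕ y) ∧ crossTerm x y xor not (toℕ x <ᵇ toℕ y) ∧ crossingAt π y x ∧ i x ∧ i y
      ≡⟨ cong (λ v → (toℕ x <ᵇ toℕ y) ∧ crossTerm x y xor not (toℕ x <ᵇ toℕ y) ∧ v ∧ i x ∧ i y)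
              (crossingAt-sym π x≢y) ⟩
    (toℕ x <ᵇ toℕ y) ∧ crossTerm x y xor not (toℕ x <ᵇ toℕ y) ∧ crossTerm x y
      ≡⟨ solve 2 (λ L C → L :* C :+ (con true :+ L) :* C := C) refl (toℕ x <ᵇ toℕ y) (crossTerm x y) ⟩
    crossTerm x y ∎

  signFun≡signFunOn-id : signFun π i ≡ signFunOn id
  signFun≡signFunOn-id = cong₂ _xor_ (Σ₂-map-tabulate linearTerm id) (begin
    Σ₂ (concatMap (λ x → map (distinguishedPair x) (allFin k)) (allFin k))
      ≡⟨ Σ₂-concatMap (λ x → map (distinguishedPair x) (allFin k)) (allFin k) ⟩
    Σ₂ (map (λ x → Σ₂ (map (distinguishedPair x) (allFin k))) (allFin k))
      ≡⟨ Σ₂-map-tabulate (λ x → Σ₂ (map (distinguishedPair x) (allFin k))) id ⟩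
    sum (λ x → Σ₂ (map (distinguishedPair x) (allFin k)))
      ≡⟨ sum-cong-≗ (λ x → trans (Σ₂-map-tabulate (distinguishedPair x) id) (sum-cong-≗ (distinguishedPair≡pairTerm x))) ⟩
    sum (λ x → sum (pairTerm x)) ∎)
    where
    distinguishedPair : Fin k → Fin k → Bool
    distinguishedPair x y = (toℕ x <ᵇ toℕ y) ∧ distPair π x y ∧ i x ∧ i y
    distinguishedPair≡pairTerm : ∀ x y → distinguishedPair x y ≡ pairTerm x y
    distinguishedPair≡pairTerm x y with x ≟ y
    ... | yes refl = trans (cong (_∧ (distPair π x x ∧ i x ∧ i x)) (<ᵇ-irrefl (toℕ x))) (sym (pairTerm-diag x))
    ... | no x≢y = cong (λ d → (toℕ x <ᵇ toℕ y) ∧ d ∧ i x ∧ i y) (distPair≡crossingAt π x≢y)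

  signFunOn-remove : ∀ {r} (e : Fin (suc r) → Fin k) (v : Fin (suc r)) → (∀ y → e (punchIn v y) ≢ e v) →
    signFunOn e ≡ linearTerm (e v) xor sum (λ y → crossTerm (e v) (e (punchIn v y))) xor signFunOn (e ∘ punchIn v)
  signFunOn-remove e v e∘punchIn≢ev =
    trans (quadForm-remove v (linearTerm ∘ e) (λ x y → pairTerm (e x) (e y)) (pairTerm-diag (e v)))
          (cong (λ u → linearTerm (e v) xor u xor signFunOn (e ∘ punchIn v))
                (sum-cong-≗ (λ y → pairTerm-xor-flip (e∘punchIn≢ev y ∘ sym))))

pinch-<ᵇ : ∀ {m} (l : Fin m) {A B : Fin (suc m)} → A ≢ inject₁ l ⊎ B ≢ suc l →
           toℕ (pinch l A) <ᵇ toℕ (pinch l B) ≡ toℕ A <ᵇ toℕ B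
pinch-<ᵇ zero {zero} {zero} _ = refl
pinch-<ᵇ zero {zero} {suc zero} A≢l⊎B≢1+l = [ contradiction refl , contradiction refl ]′ A≢l⊎B≢1+l
pinch-<ᵇ zero {zero} {suc (suc _)} _ = refl
pinch-<ᵇ zero {suc _} {zero} _ = refl
pinch-<ᵇ zero {suc a} {suc b} _ = sym (<ᵇ-suc-suc (toℕ a) (toℕ b))
pinch-<ᵇ (suc l) {zero} {zero} _ = refl
pinch-<ᵇ (suc l) {zero} {suc _} _ = refl
pinch-<ᵇ (suc l) {suc _} {zero} _ = refl
pinch-<ᵇ (suc l) {suc a} {suc b} A≢l⊎B≢1+l = begin
  suc (toℕ (pinch l a)) <ᵇ suc (toℕ (pinch l b)) ≡⟨ <ᵇ-suc-suc _ _ ⟩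
  toℕ (pinch l a) <ᵇ toℕ (pinch l b)             ≡⟨ pinch-<ᵇ l (Sum.map (_∘ cong suc) (_∘ cong suc) A≢l⊎B≢1+l) ⟩
  toℕ a <ᵇ toℕ b                                 ≡⟨ sym (<ᵇ-suc-suc _ _) ⟩
  suc (toℕ a) <ᵇ suc (toℕ b)                     ∎

crossing-pinch : ∀ {m} (l : Fin m) {A B A′ B′ : Fin (suc m)} → A ≢ inject₁ l → B ≢ inject₁ l → A′ ≢ suc l →
  crossing (toℕ (pinch l A)) (toℕ (pinch l B)) (toℕ (pinch l A′)) (toℕ (pinch l B′))
    ≡ crossing (toℕ A) (toℕ B) (toℕ A′) (toℕ B′)
crossing-pinch l A≢l B≢l A′≢1+l =
  cong₂ _xor_ (pinch-<ᵇ l (inj₁ A≢l))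
    (cong₂ _xor_ (pinch-<ᵇ l (inj₁ B≢l))
      (cong₂ _xor_ (pinch-<ᵇ l (inj₁ A≢l)) (pinch-<ᵇ l (inj₂ A′≢1+l))))

pinch-punchIn : ∀ {m} (l : Fin m) y → pinch l (punchIn (inject₁ l) y) ≡ y
pinch-punchIn zero y = refl
pinch-punchIn (suc l) zero = refl
pinch-punchIn (suc l) (suc y) = cong suc (pinch-punchIn l y)

punchIn-pinch : ∀ {m} (l : Fin m) {A} → A ≢ inject₁ l → punchIn (inject₁ l) (pinch l A) ≡ A
punchIn-pinch zero {zero} A≢l = contradiction refl A≢l
punchIn-pinch zero {suc A} _ = refl
punchIn-pinch (suc l) {zero} _ = refl
punchIn-pinch (suc l) {suc A} A≢l = cong suc (punchIn-pinch l (A≢l ∘ cong suc))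

module Merge {n : ℕ} (σ : Permutation′ (suc (suc n))) (l : Fin (suc n))
             (σc≢l+1 : σ ⟨$⟩ʳ inject₁ l ≢ suc l)
             (σ̃ : Permutation′ (suc n)) (merge : IsMerge σ l σ̃)
             (j : Fin (suc n) → Bool) where

  -- In σ the edges c and a have sources c and a = ι ac; in σ̃ the merged edge a/c has source
  -- ac, and every other edge, with source y, is the image of the edge of σ with source ι y.
  c : Fin (suc (suc n))
  c = cSrc σ l

  ι : Fin (suc n) → Fin (suc (suc n))
  ι = punchIn c

  ac : Fin (suc n)
  ac = μ l (aSrc σ l)

  a : Fin (suc (suc n))
  a = ι ac

  i : Fin (suc (suc n)) → Bool
  i = liftVars σ l j

  ι≢c : ∀ y → ι y ≢ c
  ι≢c = punchInᵢ≢i c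

  ι≢a : ∀ {y} → y ≢ ac → ι y ≢ a
  ι≢a {y} y≢ac = y≢ac ∘ punchIn-injective c y ac

  aSrc≢c : aSrc σ l ≢ c
  aSrc≢c aSrc≡c = σc≢l+1 (trans (cong (σ ⟨$⟩ʳ_) (sym aSrc≡c)) (inverseʳ σ))

  a≡aSrc : a ≡ aSrc σ l
  a≡aSrc = punchIn-pinch l aSrc≢c

  a≢c : a ≢ c
  a≢c = ι≢c ac

  σa≡l+1 : σ ⟨$⟩ʳ a ≡ suc l
  σa≡l+1 = trans (cong (σ ⟨$⟩ʳ_) a≡aSrc) (inverseʳ σ)

  σι≢l+1 : ∀ {y} → y ≢ ac → σ ⟨$⟩ʳ ι y ≢ suc l
  σι≢l+1 y≢ac σιy≡l+1 = ι≢a y≢ac (⟨$⟩ʳ-injective σ (trans σιy≡l+1 (sym σa≡l+1)))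

  σ̃-kept : ∀ {y} → y ≢ ac → σ̃ ⟨$⟩ʳ y ≡ pinch l (σ ⟨$⟩ʳ ι y)
  σ̃-kept {y} y≢ac = trans (cong (σ̃ ⟨$⟩ʳ_) (sym (pinch-punchIn l y)))
                          (proj₁ merge (ι y) ιy≢aSrc (ι≢c y))
    where
    ιy≢aSrc : ι y ≢ aSrc σ l
    ιy≢aSrc ιy≡aSrc = ι≢a y≢ac (trans ιy≡aSrc (sym a≡aSrc))

  σ̃-merged : σ̃ ⟨$⟩ʳ ac ≡ pinch l (σ ⟨$⟩ʳ c)
  σ̃-merged = proj₂ merge

  toℕ-ι : ∀ y → toℕ y ≡ toℕ (pinch l (ι y))
  toℕ-ι y = cong toℕ (sym (pinch-punchIn l y))

  i∘ι : ∀ y → i (ι y) ≡ j y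
  i∘ι y = trans (cong (λ b → if b then j ac else j (pinch l (ι y)))
                      (trans (isYes≗does (ι y ≟ c)) (dec-false (ι y ≟ c) (ι≢c y))))
                (cong j (pinch-punchIn l y))

  i-c : i c ≡ j ac
  i-c = cong (λ b → if b then j ac else j (pinch l c)) (trans (isYes≗does (c ≟ c)) (dec-true (c ≟ c) refl))

  linearTerm-kept : ∀ {y} → y ≢ ac → linearTerm σ̃ j y ≡ linearTerm σ i (ι y)
  linearTerm-kept {y} y≢ac =
    cong₂ _∧_ (trans (cong₂ _<ᵇ_ (toℕ-ι y) (cong toℕ (σ̃-kept y≢ac))) (pinch-<ᵇ l (inj₁ (ι≢c y))))
              (sym (i∘ι y))

  crossingAt-kept : ∀ {y y′} → y ≢ ac → y′ ≢ ac → crossingAt σ̃ y y′ ≡ crossingAt σ (ι y) (ι y′)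
  crossingAt-kept {y} {y′} y≢ac y′≢ac =
    trans (crossing-cong (toℕ-ι y) (toℕ-ι y′) (cong toℕ (σ̃-kept y≢ac)) (cong toℕ (σ̃-kept y′≢ac)))
          (crossing-pinch l {B′ = σ ⟨$⟩ʳ ι y′} (ι≢c y) (ι≢c y′) (σι≢l+1 y≢ac))

  pairTerm-kept : ∀ {y y′} → y ≢ ac → y′ ≢ ac → pairTerm σ̃ j y y′ ≡ pairTerm σ i (ι y) (ι y′)
  pairTerm-kept {y} {y′} y≢ac y′≢ac =
    cong₂ _∧_ (trans (cong₂ _<ᵇ_ (toℕ-ι y) (toℕ-ι y′)) (pinch-<ᵇ l {B = ι y′} (inj₁ (ι≢c y))))
              (cong₂ _∧_ (crossingAt-kept y≢ac y′≢ac) (sym (cong₂ _∧_ (i∘ι y) (i∘ι y′))))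

  signFunOn-kept : signFunOn σ̃ j (punchIn ac) ≡ signFunOn σ i (ι ∘ punchIn ac)
  signFunOn-kept =
    cong₂ _xor_ (sum-cong-≗ (λ z → linearTerm-kept (punchInᵢ≢i ac z)))
                (sum-cong-≗ (λ z → sum-cong-≗ (λ w → pairTerm-kept (punchInᵢ≢i ac z) (punchInᵢ≢i ac w))))

  crossingAt-merged : ∀ {y} → y ≢ ac → crossingAt σ̃ ac y ≡ crossingAt σ a (ι y) xor crossingAt σ c (ι y)
  crossingAt-merged {y} y≢ac = begin
    crossingAt σ̃ ac y
      ≡⟨ crossing-cong (toℕ-ι ac) (toℕ-ι y) (cong toℕ σ̃-merged) (cong toℕ (σ̃-kept y≢ac)) ⟩
    crossing (toℕ (pinch l a)) (toℕ (pinch l (ι y))) (toℕ (pinch l s)) (toℕ (pinch l t))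
      ≡⟨ crossing-pinch l {B′ = t} a≢c (ι≢c y) σc≢l+1 ⟩
    crossing (toℕ a) (toℕ (ι y)) (toℕ s) (toℕ t)
      ≡⟨ crossing-split (toℕ a) (toℕ (ι y)) (toℕ s) (toℕ t) (toℕ l) ⟩
    crossing (toℕ a) (toℕ (ι y)) (suc (toℕ l)) (toℕ t) xor crossing (toℕ l) (toℕ (ι y)) (toℕ s) (toℕ t)
      ≡⟨ sym (cong₂ _xor_ (cong (λ u → crossing (toℕ a) (toℕ (ι y)) u (toℕ t)) (cong toℕ σa≡l+1))
                          (cong (λ u → crossing u (toℕ (ι y)) (toℕ s) (toℕ t)) (toℕ-inject₁ l))) ⟩
    crossingAt σ a (ι y) xor crossingAt σ c (ι y) ∎
    where
    s t : Fin (suc (suc n))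
    s = σ ⟨$⟩ʳ c
    t = σ ⟨$⟩ʳ ι y

  crossTerm-merged : ∀ {y} → y ≢ ac → crossTerm σ̃ j ac y ≡ crossTerm σ i a (ι y) xor crossTerm σ i c (ι y)
  crossTerm-merged {y} y≢ac = begin
    crossingAt σ̃ ac y ∧ j ac ∧ j y
      ≡⟨ cong (_∧ j ac ∧ j y) (crossingAt-merged y≢ac) ⟩
    (crossingAt σ a (ι y) xor crossingAt σ c (ι y)) ∧ j ac ∧ j y
      ≡⟨ ∧-distribʳ-xor (j ac ∧ j y) (crossingAt σ a (ι y)) (crossingAt σ c (ι y)) ⟩
    crossingAt σ a (ι y) ∧ j ac ∧ j y xor crossingAt σ c (ι y) ∧ j ac ∧ j y
      ≡⟨ sym (cong₂ _xor_ (cong₂ (λ u v → crossingAt σ a (ι y) ∧ u ∧ v) (i∘ι ac) (i∘ι y))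
                          (cong₂ (λ u v → crossingAt σ c (ι y) ∧ u ∧ v) i-c (i∘ι y))) ⟩
    crossTerm σ i a (ι y) xor crossTerm σ i c (ι y) ∎

  linearTerm-merged : linearTerm σ̃ j ac ≡ linearTerm σ i c xor linearTerm σ i a xor crossTerm σ i c a
  linearTerm-merged = begin
    (toℕ ac <ᵇ toℕ (σ̃ ⟨$⟩ʳ ac)) ∧ J
      ≡⟨ cong (_∧ J) (trans (cong₂ _<ᵇ_ (toℕ-ι ac) (cong toℕ σ̃-merged)) (pinch-<ᵇ l (inj₁ a≢c))) ⟩
    (toℕ a <ᵇ s) ∧ J
      ≡⟨ cong (_∧ J) (<ᵇ-merge (toℕ a) s (toℕ l) (σc≢l+1 ∘ toℕ-injective)) ⟩
    (L xor A xor C) ∧ J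
      ≡⟨ solve 4 (λ L A C J → (L :+ (A :+ C)) :* J := L :* J :+ (A :* J :+ C :* J)) refl L A C J ⟩
    L ∧ J xor A ∧ J xor C ∧ J
      ≡⟨ cong (λ u → L ∧ J xor A ∧ J xor C ∧ u) (sym (∧-idem J)) ⟩
    L ∧ J xor A ∧ J xor C ∧ J ∧ J
      ≡⟨ sym (cong₂ _xor_ linearTerm-c (cong₂ _xor_ linearTerm-a crossTerm-c-a)) ⟩
    linearTerm σ i c xor linearTerm σ i a xor crossTerm σ i c a ∎
    where
    J L A C : Bool
    s : ℕ
    J = j ac
    s = toℕ (σ ⟨$⟩ʳ c)
    L = toℕ l <ᵇ s
    A = toℕ a <ᵇ suc (toℕ l)
    C = crossing (toℕ l) (toℕ a) s (suc (toℕ l))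
    linearTerm-c : linearTerm σ i c ≡ L ∧ J
    linearTerm-c = cong₂ _∧_ (cong (_<ᵇ s) (toℕ-inject₁ l)) i-c
    linearTerm-a : linearTerm σ i a ≡ A ∧ J
    linearTerm-a = cong₂ _∧_ (cong (toℕ a <ᵇ_) (cong toℕ σa≡l+1)) (i∘ι ac)
    crossTerm-c-a : crossTerm σ i c a ≡ C ∧ J ∧ J
    crossTerm-c-a = cong₂ _∧_ (cong₂ (λ u v → crossing u (toℕ a) s v) (toℕ-inject₁ l) (cong toℕ σa≡l+1))
                              (cong₂ _∧_ i-c (i∘ι ac))

  signFun-merge : signFun σ̃ j ≡ signFun σ i
  signFun-merge = begin
    signFun σ̃ j
      ≡⟨ signFun≡signFunOn-id σ̃ j ⟩
    signFunOn σ̃ j id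
      ≡⟨ signFunOn-remove σ̃ j id ac (punchInᵢ≢i ac) ⟩
    linearTerm σ̃ j ac xor sum (λ z → crossTerm σ̃ j ac (punchIn ac z)) xor signFunOn σ̃ j (punchIn ac)
      ≡⟨ cong₂ _xor_ linearTerm-merged
                     (cong₂ _xor_ (trans (sum-cong-≗ (λ z → crossTerm-merged (punchInᵢ≢i ac z))) (∑-distrib-+ Xa Xc))
                                  signFunOn-kept) ⟩
    (Lc xor La xor Cca) xor (sum Xa xor sum Xc) xor R
      ≡⟨ solve 6 (λ Lc La Cca Sa Sc R → (Lc :+ (La :+ Cca)) :+ ((Sa :+ Sc) :+ R)
                                      := Lc :+ ((Cca :+ Sc) :+ (La :+ (Sa :+ R))))
               refl Lc La Cca (sum Xa) (sum Xc) R ⟩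
    Lc xor (Cca xor sum Xc) xor (La xor sum Xa xor R)
      ≡⟨ sym (cong₂ (λ u v → Lc xor u xor v) (sum-remove {i = ac} (λ y → crossTerm σ i c (ι y)))
                                              (signFunOn-remove σ i ι ac (λ y → ι≢a (punchInᵢ≢i ac y)))) ⟩
    Lc xor sum (λ y → crossTerm σ i c (ι y)) xor signFunOn σ i ι
      ≡⟨ sym (signFunOn-remove σ i id c (punchInᵢ≢i c)) ⟩
    signFunOn σ i id
      ≡⟨ sym (signFun≡signFunOn-id σ i) ⟩
    signFun σ i ∎
    where
    Lc La Cca R : Bool
    Lc = linearTerm σ i c
    La = linearTerm σ i a
    Cca = crossTerm σ i c a
    Xa Xc : Fin n → Bool
    Xa z = crossTerm σ i a (ι (punchIn ac z))
    Xc z = crossTerm σ i c (ι (punchIn ac z))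
    R = signFunOn σ i (ι ∘ punchIn ac)

mainTheorem2 : (m : ℕ) (σ : Permutation′ (suc m)) (l : Fin m) →
    σ ⟨$⟩ʳ inject₁ l ≢ F.suc l →
    (σ̃ : Permutation′ m) → IsMerge σ l σ̃ →
    (j : Fin m → Bool) → signFun σ̃ j ≡ signFun σ (liftVars σ l j)
mainTheorem2 zero σ () σl≢l+1 σ̃ merge j
mainTheorem2 (suc n) σ l σl≢l+1 σ̃ merge j = Merge.signFun-merge σ l σl≢l+1 σ̃ merge j
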